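{- Let $A[1,\dots,n]$ be an array over a totally ordered set and let $B=\mathsf{BP}(\mathsf{cMin}(A))$ (positions indexed from 1). For any node $i$ with $1\le i\le n$, node $i$ is valid in $\mathsf{cMin}(A)$ if and only if $f(i)>2$ and $B[f(i)-2]=B[f(i)-1]=1$.
   Context: With $A[0]=-\infty$ and $\mathsf{PSV}(i)$ the largest $j<i$ with $A[j]<A[i]$, $\mathsf{Min}(A)$ is the rooted ordered tree on nodes $0,\dots,n$, root $0$, parent of node $i>0$ being node $\mathsf{PSV}(i)$, children ordered by increasing index (node $i$ is the $(i+1)$-th node in preorder); $\mathsf{cMin}(A)$ is this tree with node colors (irrelevant here). A node is valid if it is a non-root node that is neither the leftmost child of its parent nor the immediate right sibling of a leaf. $\mathsf{BP}(T)$ is the bit string obtained by preorder traversal of $T$, writing $0$ when a node is first visited and $1$ after its entire subtree has been visited; $f(i)$ denotes the position of the $0$ written for node $i$. -}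

module Defs where

open import Level using (Level)
open import Relation.Binary.Bundles using (StrictTotalOrder)
open import Data.Nat using (ℕ; zero; suc; _∸_; _<?_; _≟_)
open import Data.Bool using (Bool; true; false; if_then_else_; _∧_)
open import Data.List using (List; []; _∷_; _++_; map; filter; upTo)
open import Data.Vec using (Vec; lookup)
open import Data.Fin using (fromℕ<)
open import Data.Maybe using (Maybe; just; nothing)
open import Data.Product using (_×_; _,_; proj₂; ∃; ∃-syntax)
open import Relation.Nullary using (¬_; yes; no)
open import Relation.Nullary.Decidable using (isYes; ⌊_⌋)
open import Relation.Binary.PropositionalEquality using (_≡_; _≢_)

data Tree : Set where
  node : ℕ → List Tree → Tree

mutual
  lbp : Tree → List (ℕ × ℕ)
  lbp (node j ts) = (j , 0) ∷ (lbpF ts ++ ((j , 1) ∷ []))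

  lbpF : List Tree → List (ℕ × ℕ)
  lbpF [] = []
  lbpF (t ∷ ts) = lbp t ++ lbpF ts

BP : Tree → List ℕ
BP T = map proj₂ (lbp T)

-- 1-based position of the first entry (i , 0) in a labelled traversal
openPos : ℕ → List (ℕ × ℕ) → ℕ
openPos i [] = 1
openPos i ((j , b) ∷ xs) =
  if ⌊ j ≟ i ⌋ ∧ ⌊ b ≟ 0 ⌋ then 1 else suc (openPos i xs)

at : List ℕ → ℕ → Maybe ℕ
at xs zero = nothing
at [] (suc k) = nothing
at (x ∷ xs) (suc zero) = just x
at (x ∷ xs) (suc (suc k)) = at xs (suc k)

module _ {c ℓ₁ ℓ₂ : Level} (O : StrictTotalOrder c ℓ₁ ℓ₂) where
  open StrictTotalOrder O using () renaming (Carrier to X; _<?_ to _<ₒ?_)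

  -- A[k] for 1 ≤ k ≤ n (A given as Vec X n, A[1] = lookup A 0)
  entry : ∀ {n} → Vec X n → ℕ → Maybe X
  entry A zero = nothing
  entry {n} A (suc k) with k <? n
  ... | yes p = just (lookup A (fromℕ< p))
  ... | no _ = nothing

  lessM : Maybe X → Maybe X → Bool
  lessM (just x) (just y) = isYes (x <ₒ? y)
  lessM _ _ = false

  -- largest j' with 1 ≤ j' ≤ j and A[j'] < A[i], else 0 (A[0] = -∞)
  psvFrom : ∀ {n} → Vec X n → ℕ → ℕ → ℕ
  psvFrom A i zero = zero
  psvFrom A i (suc j) =
    if lessM (entry A (suc j)) (entry A i) then suc j else psvFrom A i j

  PSV : ∀ {n} → Vec X n → ℕ → ℕ
  PSV A i = psvFrom A i (i ∸ 1)

  children : ∀ {n} → Vec X n → ℕ → List ℕ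
  children {n} A j =
    filter (λ k → PSV A k ≟ j) (map (λ d → suc (j Data.Nat.+ d)) (upTo (n ∸ j)))

  -- subtree rooted at j (fuel bounds the depth; n+1 suffices)
  build : ∀ {n} → Vec X n → ℕ → ℕ → Tree
  build A zero j = node j []
  build A (suc f) j = node j (map (build A f) (children A j))

  -- Min(A) (equivalently cMin(A) with colours forgotten), root 0
  MinTree : ∀ {n} → Vec X n → Tree
  MinTree {n} A = build A (suc n) 0

  BPMin : ∀ {n} → Vec X n → List ℕ
  BPMin A = BP (MinTree A)

  fpos : ∀ {n} → Vec X n → ℕ → ℕ
  fpos A i = openPos i (lbp (MinTree A))

  siblings : ∀ {n} → Vec X n → ℕ → List ℕ
  siblings A i = children A (PSV A i)

  LeftmostChild : ∀ {n} → Vec X n → ℕ → Set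
  LeftmostChild A i = ∃[ rest ] siblings A i ≡ i ∷ rest

  ImmRightSiblingOfLeaf : ∀ {n} → Vec X n → ℕ → Set
  ImmRightSiblingOfLeaf A i =
    ∃[ pre ] ∃[ s ] ∃[ post ]
      (siblings A i ≡ pre ++ (s ∷ i ∷ post)) × (children A s ≡ [])

  Valid : ∀ {n} → Vec X n → ℕ → Set
  Valid A i = (i ≢ 0) × ¬ LeftmostChild A i × ¬ ImmRightSiblingOfLeaf A i

{-# OPTIONS --safe #-}
module Submission where

-- In the traversal, the 0 of i follows
-- the 0 of its parent when i is a leftmost child; otherwise it follows the traversal of its
-- left sibling s, which ends in 01 when s is a leaf and in 11 (closing the last child of s,
-- then s) when it is not. The real work is showing that this 0 is the first one labelled i:
-- descending from the root along the chain of parents, the traversal before the subtree of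
-- each node opens none of its descendants, because distinct siblings have disjoint subtrees.

open import Defs
open import Level using (Level)
open import Relation.Binary.Bundles using (StrictTotalOrder)
open import Data.Nat using (ℕ; zero; suc; _+_; _≤_; _<_; _∸_; _≟_; z≤n; s≤s)
open import Data.Nat.Properties
open import Data.Nat.Induction using (<-rec)
open import Data.Vec using (Vec)
open import Data.Bool using (true; false)
open import Data.Maybe using (just)
open import Data.Maybe.Properties using (just-injective)
open import Data.Product using (_×_; _,_; proj₁; proj₂; ∃; ∃₂)
open import Data.Sum using (_⊎_; inj₁; inj₂)
open import Data.Empty using (⊥-elim)
open import Data.List using (List; []; _∷_; _++_; _∷ʳ_; map; upTo; length; initLast; _∷ʳ′_)
open import Data.List.Properties
  using ( map-++; ++-assoc; ++-identityʳ; length-++; length-map; ∷-injective; ∷ʳ-injective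
        ; ++-conicalʳ; ++-monoid)
open import Data.List.Relation.Unary.All as All using (All; []; _∷_)
import Data.List.Relation.Unary.All.Properties as All
open import Data.List.Relation.Unary.AllPairs using (_∷_)
open import Data.List.Relation.Unary.Any using (here; there)
open import Data.List.Relation.Unary.Unique.Propositional using (Unique)
import Data.List.Relation.Unary.Unique.Propositional.Properties as Unique
open import Data.List.Membership.Propositional using (_∈_; _∉_)
open import Data.List.Membership.Propositional.Properties
  using (∈-++⁺ʳ; ∈-++⁺ˡ; ∈-∃++; ∈-filter⁺; ∈-filter⁻; ∈-map⁺; ∈-map⁻; ∈-upTo⁺)
open import Function.Base using (_∘_)
open import Function.Bundles using (_⇔_; mk⇔; module Equivalence)
open import Relation.Nullary using (¬_; yes; no)
open import Relation.Binary.PropositionalEquality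
  using (_≡_; _≢_; refl; sym; trans; cong; subst; module ≡-Reasoning)
open import Algebra.Solver.Monoid (++-monoid (ℕ × ℕ)) using (solve; _⊜_; _⊕_)

snocView : ∀ {a} {X : Set a} (xs : List X) → xs ≡ [] ⊎ ∃₂ λ ys y → xs ≡ ys ∷ʳ y
snocView xs with initLast xs
... | [] = inj₁ refl
... | ys ∷ʳ′ y = inj₂ (ys , y , refl)

Unique-++-∷⇒∉ : ∀ {a} {X : Set a} (xs : List X) {y ys} → Unique (xs ++ y ∷ ys) → y ∉ xs
Unique-++-∷⇒∉ (x ∷ xs) (x≢ ∷ _) (here refl) = All.lookup x≢ (∈-++⁺ʳ xs (here refl)) refl
Unique-++-∷⇒∉ (x ∷ xs) (_ ∷ u) (there y∈xs) = Unique-++-∷⇒∉ xs u y∈xs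

∈-split : ∀ {a} {X : Set a} {xs : List X} ys {y zs} → xs ≡ ys ++ y ∷ zs → y ∈ xs
∈-split ys refl = ∈-++⁺ʳ ys (here refl)

Unique-split : ∀ {a} {X : Set a} (xs : List X) {y ys} zs {ws} →
  Unique (xs ++ y ∷ ys) → xs ++ y ∷ ys ≡ zs ++ y ∷ ws → xs ≡ zs
Unique-split [] [] _ _ = refl
Unique-split [] (z ∷ zs) u refl = ⊥-elim (Unique.Unique[x∷xs]⇒x∉xs u (∈-++⁺ʳ zs (here refl)))
Unique-split (x ∷ xs) [] u refl = ⊥-elim (Unique.Unique[x∷xs]⇒x∉xs u (∈-++⁺ʳ xs (here refl)))
Unique-split (x ∷ xs) (z ∷ zs) (_ ∷ u) eq with refl , eq′ ← ∷-injective eq =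
  cong (x ∷_) (Unique-split xs zs u eq′)

_EndsWith_ : List ℕ → List ℕ → Set
xs EndsWith bs = ∃ λ zs → xs ≡ zs ++ bs

EndsWith-++ˡ : ∀ xs {ys bs} → ys EndsWith bs → (xs ++ ys) EndsWith bs
EndsWith-++ˡ xs (zs , refl) = xs ++ zs , sym (++-assoc xs zs _)

EndsWith-∷ʳ : ∀ {xs bs} b → xs EndsWith bs → (xs ∷ʳ b) EndsWith (bs ∷ʳ b)
EndsWith-∷ʳ b (zs , refl) = zs , ++-assoc zs _ (b ∷ [])

at-++-∷ : ∀ zs (b : ℕ) ws → at (zs ++ b ∷ ws) (suc (length zs)) ≡ just b
at-++-∷ [] b ws = refl
at-++-∷ (z ∷ zs) b ws = at-++-∷ zs b ws

at-++-∷-∷ : ∀ zs (b₁ b₂ : ℕ) ws → at (zs ++ b₁ ∷ b₂ ∷ ws) (2 + length zs) ≡ just b₂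
at-++-∷-∷ [] b₁ b₂ ws = refl
at-++-∷-∷ (z ∷ zs) b₁ b₂ ws = at-++-∷-∷ zs b₁ b₂ ws

TwoClosingsBefore : List ℕ → ℕ → Set
TwoClosingsBefore B k = 2 < k × at B (k ∸ 2) ≡ just 1 × at B (k ∸ 1) ≡ just 1

twoClosingsBefore⇔ : ∀ {B k} zs b₁ b₂ ws → B ≡ zs ++ b₁ ∷ b₂ ∷ ws → k ≡ 3 + length zs →
  TwoClosingsBefore B k ⇔ (b₁ ≡ 1 × b₂ ≡ 1)
twoClosingsBefore⇔ zs b₁ b₂ ws refl refl = mk⇔
  (λ (_ , B₁ , B₂) → just-injective (trans (sym (at-++-∷ zs b₁ _)) B₁) ,
                     just-injective (trans (sym (at-++-∷-∷ zs b₁ b₂ ws)) B₂))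
  (λ { (refl , refl) → s≤s (s≤s (s≤s z≤n)) , at-++-∷ zs 1 _ , at-++-∷-∷ zs 1 1 ws })

¬twoClosingsBefore : ∀ {B k} zs ws → B ≡ zs ++ 0 ∷ ws → k ≡ 2 + length zs →
  ¬ TwoClosingsBefore B k
¬twoClosingsBefore zs ws refl refl (_ , _ , B₁) with () ← trans (sym (at-++-∷ zs 0 ws)) B₁

lbpF-++ : ∀ ts us → lbpF (ts ++ us) ≡ lbpF ts ++ lbpF us
lbpF-++ [] us = refl
lbpF-++ (t ∷ ts) us = trans (cong (lbp t ++_) (lbpF-++ ts us)) (sym (++-assoc (lbp t) (lbpF ts) (lbpF us)))

lbpF-∷ʳ : ∀ ts t → lbpF (ts ∷ʳ t) ≡ lbpF ts ++ lbp t
lbpF-∷ʳ ts t = trans (lbpF-++ ts (t ∷ [])) (cong (lbpF ts ++_) (++-identityʳ (lbp t)))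

All-lbpF⁺ : ∀ {p} {Q : ℕ × ℕ → Set p} ts → All (λ t → All Q (lbp t)) ts → All Q (lbpF ts)
All-lbpF⁺ [] [] = []
All-lbpF⁺ (t ∷ ts) (Qt ∷ Qts) = All.++⁺ Qt (All-lbpF⁺ ts Qts)

lbp-node-++-∷ : ∀ X Y m ts t us →
  X ++ lbp (node m (ts ++ t ∷ us)) ++ Y ≡ (X ++ (m , 0) ∷ lbpF ts) ++ lbp t ++ lbpF us ++ (m , 1) ∷ Y
lbp-node-++-∷ X Y m ts t us = begin
  X ++ ((m , 0) ∷ lbpF (ts ++ t ∷ us) ++ (m , 1) ∷ []) ++ Y
    ≡⟨ cong (λ zs → X ++ ((m , 0) ∷ zs ++ (m , 1) ∷ []) ++ Y) (lbpF-++ ts (t ∷ us)) ⟩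
  X ++ ((m , 0) ∷ (lbpF ts ++ lbp t ++ lbpF us) ++ (m , 1) ∷ []) ++ Y
    ≡⟨ solve 7 (λ x o a b c e y → x ⊕ ((o ⊕ ((a ⊕ (b ⊕ c)) ⊕ e)) ⊕ y)
                               ⊜ (x ⊕ (o ⊕ a)) ⊕ (b ⊕ (c ⊕ (e ⊕ y))))
         refl X ((m , 0) ∷ []) (lbpF ts) (lbp t) (lbpF us) ((m , 1) ∷ []) Y ⟩
  (X ++ (m , 0) ∷ lbpF ts) ++ lbp t ++ lbpF us ++ (m , 1) ∷ Y ∎
  where open ≡-Reasoning

BP-node : ∀ j ts → BP (node j ts) ≡ (0 ∷ map proj₂ (lbpF ts)) ∷ʳ 1
BP-node j ts = cong (0 ∷_) (map-++ proj₂ (lbpF ts) _)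

EndsWith-map-++ : ∀ {a} {X : Set a} (f : X → ℕ) xs {ys bs} →
  map f ys EndsWith bs → map f (xs ++ ys) EndsWith bs
EndsWith-map-++ f xs ys-ends = subst (_EndsWith _) (sym (map-++ f xs _)) (EndsWith-++ˡ (map f xs) ys-ends)

EndsWith-lbpF-∷ʳ : ∀ ts t {bs} → BP t EndsWith bs → map proj₂ (lbpF (ts ∷ʳ t)) EndsWith bs
EndsWith-lbpF-∷ʳ ts t t-ends = subst (_EndsWith _) (cong (map proj₂) (sym (lbpF-∷ʳ ts t)))
  (EndsWith-map-++ proj₂ (lbpF ts) t-ends)

BP-EndsWith-closing : ∀ t → BP t EndsWith (1 ∷ [])
BP-EndsWith-closing (node j ts) = 0 ∷ map proj₂ (lbpF ts) , BP-node j ts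

BP-EndsWith-two-closings : ∀ s ts t → BP (node s (ts ∷ʳ t)) EndsWith (1 ∷ 1 ∷ [])
BP-EndsWith-two-closings s ts t = subst (_EndsWith (1 ∷ 1 ∷ [])) (sym (BP-node s (ts ∷ʳ t)))
  (EndsWith-∷ʳ 1 (EndsWith-++ˡ (0 ∷ []) (EndsWith-lbpF-∷ʳ ts t (BP-EndsWith-closing t))))

EndsWith-prefix : ∀ X e (g : ℕ → Tree) xs x {bs} → BP (g x) EndsWith bs →
  map proj₂ (X ++ e ∷ lbpF (map g (xs ∷ʳ x))) EndsWith bs
EndsWith-prefix X e g xs x gx-ends = EndsWith-map-++ proj₂ X (EndsWith-++ˡ (proj₂ e ∷ [])
  (subst (λ ts → map proj₂ (lbpF ts) EndsWith _) (sym (map-++ g xs (x ∷ [])))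
    (EndsWith-lbpF-∷ʳ (map g xs) (g x) gx-ends)))

openPos-++-∷ : ∀ i X W → (i , 0) ∉ X → openPos i (X ++ (i , 0) ∷ W) ≡ suc (length X)
openPos-++-∷ i [] W _ with i ≟ i
... | yes _ = refl
... | no i≢i = ⊥-elim (i≢i refl)
openPos-++-∷ i ((j , b) ∷ X) W fresh with j ≟ i | b ≟ 0
... | yes refl | yes refl = ⊥-elim (fresh (here refl))
... | yes _ | no _ = cong suc (openPos-++-∷ i X W (fresh ∘ there))
... | no _ | _ = cong suc (openPos-++-∷ i X W (fresh ∘ there))

opening-position : ∀ {i L X W} zs bs →
  L ≡ X ++ (i , 0) ∷ W → (i , 0) ∉ X → map proj₂ X ≡ zs ++ bs →
  map proj₂ L ≡ zs ++ bs ++ 0 ∷ map proj₂ W × openPos i L ≡ suc (length bs + length zs)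
opening-position {i} {X = X} {W} zs bs refl fresh bitsX =
  (begin
    map proj₂ (X ++ (i , 0) ∷ W)      ≡⟨ map-++ proj₂ X _ ⟩
    map proj₂ X ++ 0 ∷ map proj₂ W    ≡⟨ cong (_++ 0 ∷ map proj₂ W) bitsX ⟩
    (zs ++ bs) ++ 0 ∷ map proj₂ W     ≡⟨ ++-assoc zs bs _ ⟩
    zs ++ bs ++ 0 ∷ map proj₂ W       ∎) ,
  (begin
    openPos i (X ++ (i , 0) ∷ W)      ≡⟨ openPos-++-∷ i X W fresh ⟩
    suc (length X)                    ≡⟨ cong suc (length-map proj₂ X) ⟨
    suc (length (map proj₂ X))        ≡⟨ cong (suc ∘ length) bitsX ⟩
    suc (length (zs ++ bs))           ≡⟨ cong suc (trans (length-++ zs) (+-comm (length zs) (length bs))) ⟩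
    suc (length bs + length zs)       ∎)
  where open ≡-Reasoning

twoClosingsBeforeOpening⇔ : ∀ {i L X W b₁ b₂} → L ≡ X ++ (i , 0) ∷ W → (i , 0) ∉ X →
  map proj₂ X EndsWith (b₁ ∷ b₂ ∷ []) →
  TwoClosingsBefore (map proj₂ L) (openPos i L) ⇔ (b₁ ≡ 1 × b₂ ≡ 1)
twoClosingsBeforeOpening⇔ L≡ fresh (zs , bitsX) with B≡ , k≡ ← opening-position zs _ L≡ fresh bitsX =
  twoClosingsBefore⇔ zs _ _ _ B≡ k≡

¬twoClosingsBeforeOpening : ∀ {i L X W} → L ≡ X ++ (i , 0) ∷ W → (i , 0) ∉ X →
  map proj₂ X EndsWith (0 ∷ []) → ¬ TwoClosingsBefore (map proj₂ L) (openPos i L)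
¬twoClosingsBeforeOpening L≡ fresh (zs , bitsX) with B≡ , k≡ ← opening-position zs _ L≡ fresh bitsX =
  ¬twoClosingsBefore zs _ B≡ k≡

module MinTreeBP {c ℓ₁ ℓ₂ : Level} (O : StrictTotalOrder c ℓ₁ ℓ₂) {n : ℕ}
    (A : Vec (StrictTotalOrder.Carrier O) n) where

  parent : ℕ → ℕ
  parent = PSV O A

  childrenOf : ℕ → List ℕ
  childrenOf = children O A

  subtree : ℕ → ℕ → Tree
  subtree = build O A

  psvFrom≤ : ∀ i j → psvFrom O A i j ≤ j
  psvFrom≤ i zero = z≤n
  psvFrom≤ i (suc j) with lessM O (entry O A (suc j)) (entry O A i)
  ... | true = ≤-refl
  ... | false = m≤n⇒m≤1+n (psvFrom≤ i j)

  parent≤ : ∀ m → parent m ≤ m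
  parent≤ zero = z≤n
  parent≤ (suc k) = m≤n⇒m≤1+n (psvFrom≤ (suc k) k)

  parent< : ∀ {m} → 1 ≤ m → parent m < m
  parent< {suc k} _ = s≤s (psvFrom≤ (suc k) k)

  candidates : ℕ → List ℕ
  candidates j = map (λ d → suc (j + d)) (upTo (n ∸ j))

  ∈-children⁻ : ∀ j {k} → k ∈ childrenOf j → j < k × parent k ≡ j
  ∈-children⁻ j k∈ with k∈range , Pk≡j ← ∈-filter⁻ (λ k → parent k ≟ j) {xs = candidates j} k∈
                       with d , _ , refl ← ∈-map⁻ (λ d → suc (j + d)) k∈range =
    s≤s (m≤m+n j d) , Pk≡j

  ∈-children-parent : ∀ m → 1 ≤ m → m ≤ n → m ∈ childrenOf (parent m)
  ∈-children-parent m@(suc k) _ m≤n = ∈-filter⁺ (λ x → parent x ≟ parent m) m∈range refl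
    where
      p≤k : parent m ≤ k
      p≤k = psvFrom≤ m k
      m∈range : m ∈ candidates (parent m)
      m∈range = subst (_∈ candidates (parent m)) (cong suc (m+[n∸m]≡n p≤k))
                  (∈-map⁺ (λ d → suc (parent m + d)) (∈-upTo⁺ (∸-monoˡ-< m≤n p≤k)))

  children-unique : ∀ j → Unique (childrenOf j)
  children-unique j = Unique.filter⁺ (λ k → parent k ≟ j)
    (Unique.map⁺ (+-cancelˡ-≡ j _ _ ∘ suc-injective) (Unique.upTo⁺ (n ∸ j)))

  children-split : ∀ {p i xs ys zs ws} →
    childrenOf p ≡ xs ++ i ∷ ys → childrenOf p ≡ zs ++ i ∷ ws → xs ≡ zs
  children-split {p} {xs = xs} {zs = zs} e₁ e₂ =
    Unique-split xs zs (subst Unique e₁ (children-unique p)) (trans (sym e₁) e₂)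

  data _≼_ (k : ℕ) : ℕ → Set where
    self : k ≼ k
    up : ∀ {m} → k ≼ parent m → k ≼ m

  ≼⇒≤ : ∀ {k m} → k ≼ m → k ≤ m
  ≼⇒≤ self = ≤-refl
  ≼⇒≤ (up {m} k≼) = ≤-trans (≼⇒≤ k≼) (parent≤ m)

  ≼-trans : ∀ {k l m} → k ≼ l → l ≼ m → k ≼ m
  ≼-trans k≼l self = k≼l
  ≼-trans k≼l (up l≼) = up (≼-trans k≼l l≼)

  ≼-linear : ∀ {k l m} → k ≼ m → l ≼ m → k ≼ l ⊎ l ≼ k
  ≼-linear self l≼m = inj₂ l≼m
  ≼-linear (up k≼) self = inj₁ (up k≼)
  ≼-linear (up k≼) (up l≼) = ≼-linear k≼ l≼

  parent-≼ : ∀ {k m} → parent m ≡ k → k ≼ m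
  parent-≼ refl = up self

  child-not-≼-parent : ∀ {p k l} → k ∈ childrenOf p → l ∈ childrenOf p → ¬ k ≼ parent l
  child-not-≼-parent {p} k∈ l∈ k≼Pl =
    <⇒≱ (proj₁ (∈-children⁻ p k∈)) (≼⇒≤ (subst (_ ≼_) (proj₂ (∈-children⁻ p l∈)) k≼Pl))

  siblings-common-descendant⇒≡ : ∀ {p k l m} → k ∈ childrenOf p → l ∈ childrenOf p →
    k ≼ m → l ≼ m → k ≡ l
  siblings-common-descendant⇒≡ {p} k∈ l∈ k≼m l≼m with ≼-linear k≼m l≼m
  ... | inj₁ self = refl
  ... | inj₂ self = refl
  ... | inj₁ (up k≼Pl) = ⊥-elim (child-not-≼-parent {p} k∈ l∈ k≼Pl)
  ... | inj₂ (up l≼Pk) = ⊥-elim (child-not-≼-parent {p} l∈ k∈ l≼Pk)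

  lbp-subtree-≼ : ∀ f k → All (λ e → k ≼ proj₁ e) (lbp (subtree f k))
  lbp-subtree-≼ zero k = self ∷ self ∷ []
  lbp-subtree-≼ (suc f) k = self ∷ All.++⁺ (All-lbpF⁺ _ (All.map⁺ (All.tabulate below))) (self ∷ [])
    where
      below : ∀ {l} → l ∈ childrenOf k → All (λ e → k ≼ proj₁ e) (lbp (subtree f l))
      below l∈ = All.map (≼-trans (parent-≼ (proj₂ (∈-children⁻ k l∈)))) (lbp-subtree-≼ f _)

  OpensOutside : ℕ → ℕ × ℕ → Set
  OpensOutside m (k , b) = b ≡ 0 → ¬ m ≼ k

  OpensOutside-≼ : ∀ {l m} → l ≼ m → ∀ {e} → OpensOutside l e → OpensOutside m e
  OpensOutside-≼ l≼m out b≡0 m≼k = out b≡0 (≼-trans l≼m m≼k)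

  record Located (m : ℕ) : Set where
    constructor located
    field
      fuel : ℕ
      -- Each descent lowers the fuel by one and raises the label by at least one, so the
      -- truncation of build at depth fuel never cuts off a node ≤ n.
      enough : suc n ≤ fuel + m
      before after : List (ℕ × ℕ)
      traversal : lbp (MinTree O A) ≡ before ++ lbp (subtree fuel m) ++ after
      fresh : All (OpensOutside m) before

  descend : ∀ {m c pre post} → Located m → childrenOf m ≡ pre ++ c ∷ post → c ≤ n → Located c
  descend {m} {pre = pre} (located zero enough _ _ _ _) sibs c≤n =
    ⊥-elim (<⇒≱ (proj₁ (∈-children⁻ m (∈-split pre sibs))) (≤-trans c≤n (≤-trans (n≤1+n n) enough)))
  descend {m} {c} {pre} {post} (located (suc f) enough X Y traversal fresh) sibs c≤n =
    located f enough′ (X ++ (m , 0) ∷ lbpF (map (subtree f) pre)) (lbpF (map (subtree f) post) ++ (m , 1) ∷ Y)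
      traversal′
      (All.++⁺ (All.map (OpensOutside-≼ m≼c) fresh)
               ((λ _ c≼m → <⇒≱ m<c (≼⇒≤ c≼m)) ∷ pre-outside))
    where
      open ≡-Reasoning
      c∈ : c ∈ childrenOf m
      c∈ = ∈-split pre sibs
      m<c : m < c
      m<c = proj₁ (∈-children⁻ m c∈)
      m≼c : m ≼ c
      m≼c = parent-≼ (proj₂ (∈-children⁻ m c∈))

      enough′ : suc n ≤ f + c
      enough′ = ≤-trans enough (≤-trans (≤-reflexive (sym (+-suc f m))) (+-monoʳ-≤ f m<c))

      traversal′ : lbp (MinTree O A) ≡ (X ++ (m , 0) ∷ lbpF (map (subtree f) pre))
                     ++ lbp (subtree f c) ++ lbpF (map (subtree f) post) ++ (m , 1) ∷ Y
      traversal′ = begin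
        lbp (MinTree O A)
          ≡⟨ traversal ⟩
        X ++ lbp (node m (map (subtree f) (childrenOf m))) ++ Y
          ≡⟨ cong (λ cs → X ++ lbp (node m (map (subtree f) cs)) ++ Y) sibs ⟩
        X ++ lbp (node m (map (subtree f) (pre ++ c ∷ post))) ++ Y
          ≡⟨ cong (λ ts → X ++ lbp (node m ts) ++ Y) (map-++ (subtree f) pre _) ⟩
        X ++ lbp (node m (map (subtree f) pre ++ subtree f c ∷ map (subtree f) post)) ++ Y
          ≡⟨ lbp-node-++-∷ X Y m (map (subtree f) pre) (subtree f c) (map (subtree f) post) ⟩
        (X ++ (m , 0) ∷ lbpF (map (subtree f) pre))
          ++ lbp (subtree f c) ++ lbpF (map (subtree f) post) ++ (m , 1) ∷ Y ∎

      sibling-outside : ∀ {k} → k ∈ pre → All (OpensOutside c) (lbp (subtree f k))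
      sibling-outside {k} k∈ = All.map
        (λ k≼e _ c≼e → c∉pre (subst (_∈ pre) (siblings-common-descendant⇒≡ {m} k∈′ c∈ k≼e c≼e) k∈))
        (lbp-subtree-≼ f k)
        where
          k∈′ : k ∈ childrenOf m
          k∈′ = subst (k ∈_) (sym sibs) (∈-++⁺ˡ k∈)
          c∉pre : c ∉ pre
          c∉pre = Unique-++-∷⇒∉ pre (subst Unique sibs (children-unique m))

      pre-outside : All (OpensOutside c) (lbpF (map (subtree f) pre))
      pre-outside = All-lbpF⁺ _ (All.map⁺ (All.tabulate sibling-outside))

  locate : ∀ m → m ≤ n → Located m
  locate = <-rec (λ m → m ≤ n → Located m) go
    where
      go : ∀ m → (∀ {k} → k < m → k ≤ n → Located k) → m ≤ n → Located m
      go zero _ _ = located (suc n) (≤-reflexive (sym (+-identityʳ _))) [] [] (sym (++-identityʳ _)) []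
      go m@(suc _) rec m≤n with pre , post , sibs ← ∈-∃++ (∈-children-parent m (s≤s z≤n) m≤n) =
        descend (rec (parent< (s≤s z≤n)) (≤-trans (parent≤ m) m≤n)) sibs m≤n

  record OpeningContext (i : ℕ) : Set where
    constructor context
    field
      fuel : ℕ
      before after : List (ℕ × ℕ)
      pre post : List ℕ
      leftSiblings : childrenOf (parent i) ≡ pre ++ i ∷ post
      traversal : lbp (MinTree O A) ≡
        (before ++ (parent i , 0) ∷ lbpF (map (subtree (suc fuel)) pre)) ++ (i , 0) ∷ after
      fresh : (i , 0) ∉ before ++ (parent i , 0) ∷ lbpF (map (subtree (suc fuel)) pre)

  openingContext : ∀ i → 1 ≤ i → i ≤ n → OpeningContext i
  openingContext i 1≤i i≤n
    with locate (parent i) (≤-trans (parent≤ i) i≤n) | ∈-∃++ (∈-children-parent i 1≤i i≤n)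
  ... | located zero enough _ _ _ _ | _ =
    ⊥-elim (<-irrefl refl (≤-trans enough (≤-trans (parent≤ i) i≤n)))
  ... | located (suc zero) enough _ _ _ _ | _ =
    ⊥-elim (<-irrefl refl (≤-trans (≤-trans enough (parent< 1≤i)) i≤n))
  ... | L@(located (suc (suc f)) _ X _ _ _) | pre , post , sibs =
    context f X _ pre post sibs (Located.traversal L′) (λ i∈ → All.lookup (Located.fresh L′) i∈ refl self)
    where
      L′ : Located i
      L′ = descend L sibs i≤n

  BP-subtree-leaf : ∀ f s → childrenOf s ≡ [] → BP (subtree (suc f) s) EndsWith (0 ∷ 1 ∷ [])
  BP-subtree-leaf f s leaf = [] , cong (λ cs → BP (node s (map (subtree f) cs))) leaf

  BP-subtree-internal : ∀ f s {cs c} → childrenOf s ≡ cs ∷ʳ c →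
    BP (subtree (suc f) s) EndsWith (1 ∷ 1 ∷ [])
  BP-subtree-internal f s {cs} {c} internal = subst (_EndsWith (1 ∷ 1 ∷ []))
    (sym (cong (λ ts → BP (node s ts))
      (trans (cong (map (subtree f)) internal) (map-++ (subtree f) cs (c ∷ [])))))
    (BP-EndsWith-two-closings s (map (subtree f) cs) (subtree f c))

  valid-after-internal : ∀ {i pre post s cs c} → 1 ≤ i →
    childrenOf (parent i) ≡ (pre ∷ʳ s) ++ i ∷ post →
    childrenOf s ≡ cs ∷ʳ c → Valid O A i
  valid-after-internal {i} {pre} {post} {s} {cs} {c} 1≤i sibs internal =
    m<n⇒n≢0 1≤i , ¬leftmost , ¬afterLeaf
    where
      ¬leftmost : ¬ LeftmostChild O A i
      ¬leftmost (_ , leftmost)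
        with () ← ++-conicalʳ pre (s ∷ []) (sym (children-split {p = parent i} leftmost sibs))
      ¬afterLeaf : ¬ ImmRightSiblingOfLeaf O A i
      ¬afterLeaf (pre₂ , s₂ , _ , sibs₂ , leaf)
        with _ , refl ← ∷ʳ-injective pre₂ pre
               (children-split {p = parent i} (trans sibs₂ (sym (++-assoc pre₂ (s₂ ∷ []) _))) sibs)
        with () ← ++-conicalʳ cs (c ∷ []) (trans (sym internal) leaf)

  valid⇔twoClosingsBefore : ∀ i → 1 ≤ i → i ≤ n →
    Valid O A i ⇔ TwoClosingsBefore (BPMin O A) (fpos O A i)
  valid⇔twoClosingsBefore i 1≤i i≤n with openingContext i 1≤i i≤n
  ... | context f X _ pre post sibs traversal fresh with snocView pre
  ...   | inj₁ refl = mk⇔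
    (λ (_ , ¬leftmost , _) → ⊥-elim (¬leftmost (post , sibs)))
    (⊥-elim ∘ ¬twoClosingsBeforeOpening traversal fresh (map proj₂ X , map-++ proj₂ X _))
  ...   | inj₂ (pre′ , s , refl) with snocView (childrenOf s)
  ...     | inj₁ leaf = mk⇔
    (λ (_ , _ , ¬afterLeaf) → ⊥-elim (¬afterLeaf (pre′ , s , post , trans sibs (++-assoc pre′ _ _) , leaf)))
    (λ closings → ⊥-elim (0≢1+n
      (proj₁ (Equivalence.to (twoClosingsBeforeOpening⇔ traversal fresh ends) closings))))
    where
      ends : map proj₂ (X ++ (parent i , 0) ∷ lbpF (map (subtree (suc f)) (pre′ ∷ʳ s)))
               EndsWith (0 ∷ 1 ∷ [])
      ends = EndsWith-prefix X (parent i , 0) (subtree (suc f)) pre′ s (BP-subtree-leaf f s leaf)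
  ...     | inj₂ (_ , _ , internal) = mk⇔
    (λ _ → Equivalence.from (twoClosingsBeforeOpening⇔ traversal fresh ends) (refl , refl))
    (λ _ → valid-after-internal 1≤i sibs internal)
    where
      ends : map proj₂ (X ++ (parent i , 0) ∷ lbpF (map (subtree (suc f)) (pre′ ∷ʳ s)))
               EndsWith (1 ∷ 1 ∷ [])
      ends = EndsWith-prefix X (parent i , 0) (subtree (suc f)) pre′ s (BP-subtree-internal f s internal)

lemma4 : ∀ {c ℓ₁ ℓ₂ : Level} (O : StrictTotalOrder c ℓ₁ ℓ₂) (n : ℕ)
    (A : Vec (StrictTotalOrder.Carrier O) n) (i : ℕ) → 1 ≤ i → i ≤ n →
    Valid O A i ⇔
      (2 < fpos O A i
        × at (BPMin O A) (fpos O A i ∸ 2) ≡ just 1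
        × at (BPMin O A) (fpos O A i ∸ 1) ≡ just 1)
lemma4 O n A = MinTreeBP.valid⇔twoClosingsBefore O A
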